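{- Let $k\ge 1$ be an integer and let $G$ be a $k$-uniform hypergraph with $n$ vertices and $m$ edges. Define $f:\{k-1,k,\ldots,n\}\to\mathbb{Q}$ by $$f(i)=\frac{\binom{n}{i+1}}{\binom{n}{i-k+1}}=\frac{(n-i)(n-i+1)\cdots(n-i+k-1)}{(i+1)\,i\,(i-1)\cdots(i-k+2)}$$ for every $i\in\{k-1,\ldots,n\}$, and let $$\ell(G)=\min\{\,i\in\{k-1,\ldots,n\}\;:\; f(i)\le m\,\}.$$ Then $\ell(G)\le\alpha(G)$.
   Context: A $k$-uniform hypergraph $G$ consists of a finite vertex set $V(G)$ and a set $E(G)$ of $k$-element subsets of $V(G)$ (the edges). An independent set of $G$ is a subset $S\subseteq V(G)$ that contains no edge of $G$. The independence number $\alpha(G)$ is the largest cardinality of an independent set of $G$. -}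

module Defs where

open import Data.Nat using (ℕ; zero; suc; _∸_; _≤_; _<_; z≤n; s≤s; >-nonZero)
open import Data.Nat.Properties using (≤-trans; m≤m+n; m∸n≤m)
open import Data.Nat.Combinatorics using (_C_; nCk+nC[k+1]≡[n+1]C[k+1])
open import Data.Integer using (+_)
open import Data.Rational using (ℚ; _/_) renaming (_≤_ to _≤ℚ_)
open import Data.Fin.Subset using (Subset; _⊆_; ∣_∣)
open import Data.List using (List; length)
open import Data.List.Membership.Propositional using (_∈_)
open import Data.List.Relation.Unary.All using (All)
open import Data.List.Relation.Unary.Unique.Propositional using (Unique)
open import Data.Product using (_×_)
open import Relation.Binary.PropositionalEquality using (_≡_; subst)
open import Relation.Nullary using (¬_)

record Hypergraph (k n : ℕ) : Set where
  field
    edges   : List (Subset n)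
    unique  : Unique edges
    uniform : All (λ e → ∣ e ∣ ≡ k) edges

open Hypergraph public

numEdges : ∀ {k n} → Hypergraph k n → ℕ
numEdges G = length (edges G)

IsIndependent : ∀ {k n} → Hypergraph k n → Subset n → Set
IsIndependent G S = ∀ {e} → e ∈ edges G → ¬ (e ⊆ S)

IsIndependenceNumber : ∀ {k n} → Hypergraph k n → ℕ → Set
IsIndependenceNumber {n = n} G a =
  (Σ-indep) × (∀ (S : Subset n) → IsIndependent G S → ∣ S ∣ ≤ a)
  where
  open import Data.Product using (∃)
  Σ-indep = ∃ λ (S : Subset n) → IsIndependent G S × ∣ S ∣ ≡ a

C-pos : ∀ n r → r ≤ n → 0 < n C r
C-pos n zero _ = s≤s z≤n
C-pos (suc n) (suc r) (s≤s r≤n) =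
  subst (0 <_) (nCk+nC[k+1]≡[n+1]C[k+1] n r)
        (≤-trans (C-pos n r r≤n) (m≤m+n (n C r) (n C suc r)))

f : (n k i : ℕ) → (k ∸ 1 ≤ i) → (i ≤ n) → ℚ
f n k i _ i≤n = (+ (n C suc i)) / (n C (i ∸ (k ∸ 1)))
  where instance
    nz = >-nonZero (C-pos n (i ∸ (k ∸ 1)) (≤-trans (m∸n≤m i (k ∸ 1)) i≤n))

Isℓ : ∀ {k n} → Hypergraph k n → ℕ → Set
Isℓ {k} {n} G l =
  Data.Product.Σ (k ∸ 1 ≤ l) λ p → Data.Product.Σ (l ≤ n) λ q →
    (f n k l p q ≤ℚ (+ numEdges G / 1))
    × (∀ i (p′ : k ∸ 1 ≤ i) (q′ : i ≤ n) →
         f n k i p′ q′ ≤ℚ (+ numEdges G / 1) → l ≤ i)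
  where import Data.Product

{-# OPTIONS --safe #-}
module Submission where

-- Let a = α(G). Every (a+1)-subset of the vertices contains an edge, and a
-- k-edge lies in at most C(n, a+1-k) of the (a+1)-subsets, so double counting
-- the pairs (edge, (a+1)-set containing it) gives C(n, a+1) ≤ m C(n, a+1-k),
-- i.e. f(a) ≤ m. Sets of size k-1 are independent, so k-1 ≤ a ≤ n and the
-- minimality of ℓ gives ℓ ≤ a.

open import Defs
open import Data.Nat using (ℕ; zero; suc; _+_; _*_; _∸_; _≤_; _<_; z≤n; s≤s; NonZero; >-nonZero)
open import Data.Nat.Properties
open import Data.Nat.ListAction using (sum)
open import Data.Nat.Combinatorics using (_C_; nCk+nC[k+1]≡[n+1]C[k+1])
open import Algebra.Properties.CommutativeSemigroup +-commutativeSemigroup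
  using (interchange; x∙yz≈y∙xz)
open import Data.Vec using (_∷_; []; tail; here)
open import Data.Fin.Subset using (Subset; _⊆_; ∣_∣; ⊥; outside; inside)
open import Data.Fin.Subset.Properties using (drop-∷-⊆; ∣p∣≤n; ∣⊥∣≡0; _⊆?_; p⊆q⇒∣p∣≤∣q∣)
open import Data.List using (List; []; _∷_; length; map)
open import Data.List.Relation.Unary.Any using (Any; here; there; any?)
open import Data.List.Relation.Unary.All as All using (All; []; _∷_)
open import Data.List.Membership.Propositional using (lose)
open import Data.Product using (Σ; _,_; proj₂)
import Data.Integer as ℤ
open import Data.Integer.Properties using (pos-*)
open import Data.Rational using (_/_) renaming (_≤_ to _≤ℚ_)
open import Data.Rational.Properties using (toℚᵘ-cancel-≤; toℚᵘ-fromℚᵘ)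
open import Data.Rational.Unnormalised using (mkℚᵘ; *≤*)
open import Data.Rational.Unnormalised.Properties using (≤-respˡ-≃; ≤-respʳ-≃; ≃-sym)
open import Relation.Nullary using (yes; no; contradiction)
open import Relation.Binary.PropositionalEquality

-- The number of r-element subsets of Fin n containing e.
#supersets : ∀ {n} → Subset n → ℕ → ℕ
#supersets []            zero    = 1
#supersets []            (suc r) = 0
#supersets (outside ∷ e) zero    = #supersets e zero
#supersets (outside ∷ e) (suc r) = #supersets e (suc r) + #supersets e r
#supersets (inside ∷ e)  zero    = 0
#supersets (inside ∷ e)  (suc r) = #supersets e r

#incidences : ∀ {n} → List (Subset n) → ℕ → ℕ
#incidences E r = sum (map (λ e → #supersets e r) E)

avoiding0 : ∀ {n} → List (Subset (suc n)) → List (Subset n)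
avoiding0 []                  = []
avoiding0 ((outside ∷ e) ∷ E) = e ∷ avoiding0 E
avoiding0 ((inside ∷ e) ∷ E)  = avoiding0 E

#incidences-suc : ∀ {n} (E : List (Subset (suc n))) r →
  #incidences E (suc r) ≡ #incidences (avoiding0 E) (suc r) + #incidences (map tail E) r
#incidences-suc [] r = refl
#incidences-suc ((outside ∷ e) ∷ E) r = begin
  (#supersets e (suc r) + #supersets e r) + #incidences E (suc r)
    ≡⟨ cong (_ +_) (#incidences-suc E r) ⟩
  (#supersets e (suc r) + #supersets e r) + (#incidences (avoiding0 E) (suc r) + #incidences (map tail E) r)
    ≡⟨ interchange (#supersets e (suc r)) (#supersets e r) (#incidences (avoiding0 E) (suc r)) _ ⟩
  (#supersets e (suc r) + #incidences (avoiding0 E) (suc r)) + (#supersets e r + #incidences (map tail E) r) ∎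
  where open ≡-Reasoning
#incidences-suc ((inside ∷ e) ∷ E) r = begin
  #supersets e r + #incidences E (suc r)
    ≡⟨ cong (_ +_) (#incidences-suc E r) ⟩
  #supersets e r + (#incidences (avoiding0 E) (suc r) + #incidences (map tail E) r)
    ≡⟨ x∙yz≈y∙xz (#supersets e r) (#incidences (avoiding0 E) (suc r)) _ ⟩
  #incidences (avoiding0 E) (suc r) + (#supersets e r + #incidences (map tail E) r) ∎
  where open ≡-Reasoning

⊆⇒1≤#supersets : ∀ {n} (e T : Subset n) → e ⊆ T → 1 ≤ #supersets e ∣ T ∣
⊆⇒1≤#supersets []            []            _   = ≤-refl
⊆⇒1≤#supersets (inside ∷ e)  (inside ∷ T)  e⊆T = ⊆⇒1≤#supersets e T (drop-∷-⊆ e⊆T)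
⊆⇒1≤#supersets (inside ∷ e)  (outside ∷ T) e⊆T with () ← e⊆T here
⊆⇒1≤#supersets (outside ∷ e) (outside ∷ T) e⊆T =
  ≤-trans (⊆⇒1≤#supersets e T (drop-∷-⊆ e⊆T)) (#supersets-outside e ∣ T ∣)
  where
  #supersets-outside : ∀ {n} (e : Subset n) r → #supersets e r ≤ #supersets (outside ∷ e) r
  #supersets-outside e zero    = ≤-refl
  #supersets-outside e (suc r) = m≤m+n _ _
⊆⇒1≤#supersets (outside ∷ e) (inside ∷ T)  e⊆T =
  ≤-trans (⊆⇒1≤#supersets e T (drop-∷-⊆ e⊆T)) (m≤n+m _ _)

any⊆⇒1≤#incidences : ∀ {n} (E : List (Subset n)) T → Any (_⊆ T) E → 1 ≤ #incidences E ∣ T ∣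
any⊆⇒1≤#incidences (e ∷ E) T (here e⊆T) = ≤-trans (⊆⇒1≤#supersets e T e⊆T) (m≤m+n _ _)
any⊆⇒1≤#incidences (e ∷ E) T (there a)  = ≤-trans (any⊆⇒1≤#incidences E T a) (m≤n+m _ _)

any⊆-avoiding0 : ∀ {n} (E : List (Subset (suc n))) T →
                 Any (_⊆ outside ∷ T) E → Any (_⊆ T) (avoiding0 E)
any⊆-avoiding0 ((outside ∷ e) ∷ E) T (here e⊆T) = here (drop-∷-⊆ e⊆T)
any⊆-avoiding0 ((inside ∷ e) ∷ E)  T (here e⊆T) with () ← e⊆T here
any⊆-avoiding0 ((outside ∷ e) ∷ E) T (there a)  = there (any⊆-avoiding0 E T a)
any⊆-avoiding0 ((inside ∷ e) ∷ E)  T (there a)  = any⊆-avoiding0 E T a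

any⊆-tail : ∀ {n} (E : List (Subset (suc n))) {s} T → Any (_⊆ s ∷ T) E → Any (_⊆ T) (map tail E)
any⊆-tail ((_ ∷ e) ∷ E) T (here e⊆T) = here (drop-∷-⊆ e⊆T)
any⊆-tail (e ∷ E)       T (there a)  = there (any⊆-tail E T a)

-- Pascal's rule on both sides: the r-sets avoiding vertex 0 are covered by
-- avoiding0 E, and the tails of those containing it by the tails of all edges.
C≤#incidences : ∀ n (E : List (Subset n)) r →
                (∀ T → ∣ T ∣ ≡ r → Any (_⊆ T) E) → n C r ≤ #incidences E r
C≤#incidences n E zero covers =
  subst (λ z → 1 ≤ #incidences E z) (∣⊥∣≡0 n) (any⊆⇒1≤#incidences E ⊥ (covers ⊥ (∣⊥∣≡0 n)))
C≤#incidences zero E (suc r) covers = z≤n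
C≤#incidences (suc n) E (suc r) covers = begin
  suc n C suc r                                                  ≡⟨ nCk+nC[k+1]≡[n+1]C[k+1] n r ⟨
  n C r + n C suc r                                              ≡⟨ +-comm (n C r) _ ⟩
  n C suc r + n C r                                              ≤⟨ +-mono-≤ avoiding0-bound tail-bound ⟩
  #incidences (avoiding0 E) (suc r) + #incidences (map tail E) r ≡⟨ #incidences-suc E r ⟨
  #incidences E (suc r)                                          ∎
  where
  open ≤-Reasoning
  avoiding0-bound : n C suc r ≤ #incidences (avoiding0 E) (suc r)
  avoiding0-bound = C≤#incidences n (avoiding0 E) (suc r)
    (λ T ∣T∣≡1+r → any⊆-avoiding0 E T (covers (outside ∷ T) ∣T∣≡1+r))
  tail-bound : n C r ≤ #incidences (map tail E) r
  tail-bound = C≤#incidences n (map tail E) r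
    (λ T ∣T∣≡r → any⊆-tail E T (covers (inside ∷ T) (cong suc ∣T∣≡r)))

nCk≤[1+n]Ck : ∀ n k → n C k ≤ suc n C k
nCk≤[1+n]Ck n zero    = ≤-refl
nCk≤[1+n]Ck n (suc k) = subst (n C suc k ≤_) (nCk+nC[k+1]≡[n+1]C[k+1] n k) (m≤n+m _ _)

<∣e∣⇒#supersets≡0 : ∀ {n} (e : Subset n) r → r < ∣ e ∣ → #supersets e r ≡ 0
<∣e∣⇒#supersets≡0 (outside ∷ e) zero    r<∣e∣ = <∣e∣⇒#supersets≡0 e zero r<∣e∣
<∣e∣⇒#supersets≡0 (outside ∷ e) (suc r) r<∣e∣ =
  cong₂ _+_ (<∣e∣⇒#supersets≡0 e (suc r) r<∣e∣) (<∣e∣⇒#supersets≡0 e r (<-trans (n<1+n r) r<∣e∣))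
<∣e∣⇒#supersets≡0 (inside ∷ e)  zero    _           = refl
<∣e∣⇒#supersets≡0 (inside ∷ e)  (suc r) (s≤s r<∣e∣) = <∣e∣⇒#supersets≡0 e r r<∣e∣

-- The exact count is C(n - ∣e∣, r - ∣e∣); the weaker bound is the one in f.
#supersets≤C : ∀ {n} (e : Subset n) r → #supersets e r ≤ n C (r ∸ ∣ e ∣)
#supersets≤C []            zero    = ≤-refl
#supersets≤C []            (suc r) = z≤n
#supersets≤C {suc n} (outside ∷ e) zero = ≤-trans (#supersets≤C e zero) (nCk≤[1+n]Ck n (0 ∸ ∣ e ∣))
#supersets≤C {suc n} (outside ∷ e) (suc r) with ∣ e ∣ ≤? r
... | yes ∣e∣≤r = begin
  #supersets e (suc r) + #supersets e r ≤⟨ +-mono-≤ (#supersets≤C e (suc r)) (#supersets≤C e r) ⟩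
  n C (suc r ∸ ∣ e ∣) + n C (r ∸ ∣ e ∣) ≡⟨ cong (λ j → n C j + n C (r ∸ ∣ e ∣)) (+-∸-assoc 1 ∣e∣≤r) ⟩
  n C suc (r ∸ ∣ e ∣) + n C (r ∸ ∣ e ∣) ≡⟨ +-comm (n C suc (r ∸ ∣ e ∣)) _ ⟩
  n C (r ∸ ∣ e ∣) + n C suc (r ∸ ∣ e ∣) ≡⟨ nCk+nC[k+1]≡[n+1]C[k+1] n (r ∸ ∣ e ∣) ⟩
  suc n C suc (r ∸ ∣ e ∣)               ≡⟨ cong (suc n C_) (+-∸-assoc 1 ∣e∣≤r) ⟨
  suc n C (suc r ∸ ∣ e ∣)               ∎
  where open ≤-Reasoning
... | no ∣e∣≰r = begin
  #supersets e (suc r) + #supersets e r ≡⟨ cong (#supersets e (suc r) +_) (<∣e∣⇒#supersets≡0 e r (≰⇒> ∣e∣≰r)) ⟩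
  #supersets e (suc r) + 0              ≡⟨ +-identityʳ _ ⟩
  #supersets e (suc r)                  ≤⟨ #supersets≤C e (suc r) ⟩
  n C (suc r ∸ ∣ e ∣)                   ≤⟨ nCk≤[1+n]Ck n (suc r ∸ ∣ e ∣) ⟩
  suc n C (suc r ∸ ∣ e ∣)               ∎
  where open ≤-Reasoning
#supersets≤C (inside ∷ e) zero = z≤n
#supersets≤C {suc n} (inside ∷ e) (suc r) = ≤-trans (#supersets≤C e r) (nCk≤[1+n]Ck n (r ∸ ∣ e ∣))

sum-map≤length* : ∀ {A : Set} (f : A → ℕ) {b} (xs : List A) →
                  All (λ x → f x ≤ b) xs → sum (map f xs) ≤ length xs * b
sum-map≤length* f []       []             = z≤n
sum-map≤length* f (x ∷ xs) (fx≤b ∷ fxs≤b) = +-mono-≤ fx≤b (sum-map≤length* f xs fxs≤b)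

#incidences≤length*C : ∀ {n k} (E : List (Subset n)) r → All (λ e → ∣ e ∣ ≡ k) E →
                       #incidences E r ≤ length E * (n C (r ∸ k))
#incidences≤length*C E r uniform = sum-map≤length* (λ e → #supersets e r) E
  (All.map (λ { {e} refl → #supersets≤C e r }) uniform)

subset-of-size : ∀ n j → j ≤ n → Σ (Subset n) λ T → ∣ T ∣ ≡ j
subset-of-size n       zero    _         = ⊥ , ∣⊥∣≡0 n
subset-of-size (suc n) (suc j) (s≤s j≤n) with T , ∣T∣≡j ← subset-of-size n j j≤n =
  inside ∷ T , cong suc ∣T∣≡j

-- ℚ's _/_ normalises, so the comparison is made on unnormalised representatives.
x≤m*y⇒x/y≤m : ∀ x y m .{{_ : NonZero y}} → x ≤ m * y → (ℤ.+ x) / y ≤ℚ (ℤ.+ m) / 1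
x≤m*y⇒x/y≤m x (suc y) m x≤m*y = toℚᵘ-cancel-≤
  (≤-respˡ-≃ (≃-sym (toℚᵘ-fromℚᵘ (mkℚᵘ (ℤ.+ x) y)))
  (≤-respʳ-≃ (≃-sym (toℚᵘ-fromℚᵘ (mkℚᵘ (ℤ.+ m) 0)))
  (*≤* (subst₂ ℤ._≤_ (pos-* x 1) (pos-* m (suc y)) (ℤ.+≤+ (subst (_≤ _) (sym (*-identityʳ x)) x≤m*y))))))

module _ {k n} (G : Hypergraph k n) where

  small⇒independent : ∀ S → ∣ S ∣ < k → IsIndependent G S
  small⇒independent S ∣S∣<k {e} e∈G e⊆S =
    <⇒≱ ∣S∣<k (subst (_≤ ∣ S ∣) (All.lookup (uniform G) e∈G) (p⊆q⇒∣p∣≤∣q∣ e⊆S))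

  large⇒contains-edge : ∀ {a} → IsIndependenceNumber G a →
                        ∀ T → a < ∣ T ∣ → Any (_⊆ T) (edges G)
  large⇒contains-edge (_ , maximal) T a<∣T∣ with any? (_⊆? T) (edges G)
  ... | yes e⊆T = e⊆T
  ... | no  ∄e⊆T = contradiction (maximal T (λ e∈G e⊆T → ∄e⊆T (lose e∈G e⊆T))) (<⇒≱ a<∣T∣)

module _ {k n} (G : Hypergraph (suc k) n) {a} (α : IsIndependenceNumber G a) where

  k≤α : k ≤ n → k ≤ a
  k≤α k≤n with T , ∣T∣≡k ← subset-of-size n k k≤n =
    subst (_≤ a) ∣T∣≡k (proj₂ α T (small⇒independent G T (s≤s (≤-reflexive ∣T∣≡k))))

  C[1+α]≤m*C[α∸k] : n C suc a ≤ numEdges G * (n C (a ∸ k))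
  C[1+α]≤m*C[α∸k] = ≤-trans
    (C≤#incidences n (edges G) (suc a) (λ T ∣T∣≡1+a →
      large⇒contains-edge G α T (≤-reflexive (sym ∣T∣≡1+a))))
    (#incidences≤length*C (edges G) (suc a) (uniform G))

theorem1 : ∀ (k n : ℕ) → 1 ≤ k → (G : Hypergraph k n) →
           ∀ (l a : ℕ) → Isℓ G l → IsIndependenceNumber G a → l ≤ a
theorem1 (suc k) n _ G l a (k≤l , l≤n , _ , minimal) α@((S , _ , ∣S∣≡a) , _) =
  minimal a (k≤α G α (≤-trans k≤l l≤n)) a≤n
    (x≤m*y⇒x/y≤m (n C suc a) (n C (a ∸ k)) (numEdges G) (C[1+α]≤m*C[α∸k] G α))
  where
  a≤n : a ≤ n
  a≤n = subst (_≤ n) ∣S∣≡a (∣p∣≤n S)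
  instance
    C[α∸k]≢0 : NonZero (n C (a ∸ k))
    C[α∸k]≢0 = >-nonZero (C-pos n (a ∸ k) (≤-trans (m∸n≤m a k) a≤n))
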